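{- For any integers $n,n'\ge 2$, $(n+1)n'-2n'\le \dim_s(K_{1,n}\oplus K_{n'})\le (n+1)n'-n'-1$.
   Context: $K_{1,n}$ is the star with $n$ leaves and $K_{n'}$ the complete graph on $n'$ vertices. The Cartesian sum $G\oplus H$ of $G=(V_1,E_1)$ and $H=(V_2,E_2)$ has vertex set $V_1\times V_2$, with $(a,b)(c,d)$ an edge iff $ac\in E_1$ or $bd\in E_2$. For a connected graph $G$, a vertex $w$ strongly resolves $u,v$ if $d_G(w,u)=d_G(w,v)+d_G(v,u)$ or $d_G(w,v)=d_G(w,u)+d_G(u,v)$; $\dim_s(G)$ is the minimum cardinality of a set $S$ such that every pair of vertices is strongly resolved by some vertex of $S$. -}

module Defs where

open import Data.Nat using (ℕ; zero; suc; _+_; _≤_)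
open import Data.Fin using (Fin)
import Data.Fin as Fin
open import Data.Product using (_×_; Σ; ∃; ∃-syntax; _,_)
open import Data.Sum using (_⊎_)
open import Data.List using (List; length)
open import Data.List.Membership.Propositional using (_∈_)
open import Data.List.Relation.Unary.Unique.Propositional using (Unique)
open import Relation.Binary.PropositionalEquality using (_≡_; _≢_)

record Graph : Set₁ where
  field
    V   : Set
    Adj : V → V → Set
open Graph public

data Walk (G : Graph) : V G → V G → ℕ → Set where
  here : ∀ {u} → Walk G u u 0
  step : ∀ {u v w k} → Adj G u v → Walk G v w k → Walk G u w (suc k)

IsDist : (G : Graph) → V G → V G → ℕ → Set
IsDist G u v k = Walk G u v k × (∀ m → Walk G u v m → k ≤ m)

StronglyResolves : (G : Graph) → V G → V G → V G → Set
StronglyResolves G w u v =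
  Σ ℕ λ dwu → Σ ℕ λ dwv → Σ ℕ λ duv →
    IsDist G w u dwu × IsDist G w v dwv × IsDist G u v duv ×
    (dwu ≡ dwv + duv ⊎ dwv ≡ dwu + duv)

IsStrongResolvingSet : (G : Graph) → List (V G) → Set
IsStrongResolvingSet G S =
  ∀ u v → u ≢ v → Σ (V G) λ w → w ∈ S × StronglyResolves G w u v

IsStrongMetricDim : (G : Graph) → ℕ → Set
IsStrongMetricDim G k =
  (Σ (List (V G)) λ S → Unique S × IsStrongResolvingSet G S × length S ≡ k) ×
  (∀ S → Unique S → IsStrongResolvingSet G S → k ≤ length S)

-- Star K_{1,n}: vertices Fin (suc n), vertex 0 is the center, 1..n are leaves.
-- Edges: center -- leaf.
data StarAdj {n : ℕ} : Fin (suc n) → Fin (suc n) → Set where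
  center-leaf : (i : Fin n) → StarAdj Fin.zero (Fin.suc i)
  leaf-center : (i : Fin n) → StarAdj (Fin.suc i) Fin.zero

Star : ℕ → Graph
Star n = record { V = Fin (suc n) ; Adj = StarAdj {n} }

Complete : ℕ → Graph
Complete n = record { V = Fin n ; Adj = λ i j → i ≢ j }

_⊕_ : Graph → Graph → Graph
G ⊕ H = record
  { V   = V G × V H
  ; Adj = λ { (a , b) (c , d) → Adj G a c ⊎ Adj H b d }
  }

module Submission where

-- In G = K_{1,n} ⊕ K_{n′}, (a , b) and (c , d) are adjacent unless b = d and a, c are not
-- adjacent in the star. So distinct vertices are at distance 1, except two distinct leaf copies
-- in the same column, at distance 2. If no vertex is farther from u or from v than u and v
-- are from each other, then only u and v strongly resolve the pair {u, v}, so every strong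
-- resolving set contains one of them. The n′ centre copies form such a clique, and so do the
-- n leaf copies of each column; these n′ + 1 cliques partition V(G), so a strong resolving set
-- omits at most n′ + 1 vertices. Conversely, omitting one centre copy and one leaf copy per
-- column leaves a strong resolving set, a second leaf of the column resolving each omitted
-- pair. Hence dim_s(G) = (n + 1) n′ − n′ − 1.

open import Defs
open import Level using (0ℓ)
open import Data.Nat using (ℕ; zero; suc; _+_; _*_; _∸_; _≤_; z≤n; s≤s)
open import Data.Nat.Properties
open import Data.Fin using (Fin) renaming (zero to fz; suc to fs)
import Data.Fin as Fin
import Data.Fin.Properties as Fin
open import Data.Product using (Σ; _×_; _,_; proj₁; proj₂)
open import Data.Product.Properties using (≡-dec)
open import Data.Sum using (_⊎_; inj₁; inj₂; [_,_]′)
open import Data.Empty using (⊥; ⊥-elim)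
open import Data.Unit using (⊤; tt)
open import Data.Bool using (true; false)
open import Data.List using (List; []; _∷_; length; map; filter; _++_; allFin; cartesianProduct)
open import Data.List.Properties using (length-++; length-map; length-tabulate; length-removeAt′)
open import Data.List.Membership.Propositional using (_∈_; _─_)
open import Data.List.Membership.Propositional.Properties
  using (∈-map⁻; ∈-filter⁺; ∈-filter⁻; ∈-allFin; ∈-cartesianProduct⁺)
import Data.List.Membership.DecPropositional as DecMembership
open import Data.List.Relation.Unary.Any using (here; there)
import Data.List.Relation.Unary.All as All
open import Data.List.Relation.Unary.AllPairs using (_∷_)
open import Data.List.Relation.Unary.Unique.Propositional using (Unique)
import Data.List.Relation.Unary.Unique.Propositional.Properties as Unique
open import Relation.Nullary using (¬_; yes; no; does)
open import Relation.Unary using (Pred; Decidable)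
open import Relation.Unary.Properties using (∁?)
open import Relation.Binary.PropositionalEquality

∈-─⁺ : {A : Set} {x y : A} {xs : List A} → y ∈ xs → (x∈xs : x ∈ xs) → y ≢ x → y ∈ xs ─ x∈xs
∈-─⁺ (here y≡z)  (here x≡z)  y≢x = ⊥-elim (y≢x (trans y≡z (sym x≡z)))
∈-─⁺ (here y≡z)  (there _)   _   = here y≡z
∈-─⁺ (there y∈)  (here _)    _   = y∈
∈-─⁺ (there y∈)  (there x∈)  y≢x = there (∈-─⁺ y∈ x∈ y≢x)

module _ {A : Set} where

  length-filter+filter-∁ : {P : Pred A 0ℓ} (P? : Decidable P) (xs : List A) →
                           length (filter P? xs) + length (filter (∁? P?) xs) ≡ length xs
  length-filter+filter-∁ P? []       = refl
  length-filter+filter-∁ P? (x ∷ xs) with ih ← length-filter+filter-∁ P? xs | does (P? x)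
  ... | true  = cong suc ih
  ... | false = trans (+-suc _ _) (cong suc ih)

  length≤-injectiveOn : {B : Set} (f : A → B) {xs : List A} {ys : List B} → Unique xs →
                        (∀ {x y} → x ∈ xs → y ∈ xs → x ≢ y → f x ≢ f y) →
                        (∀ {x} → x ∈ xs → f x ∈ ys) → length xs ≤ length ys
  length≤-injectiveOn f {[]}     _          _   _    = z≤n
  length≤-injectiveOn f {x ∷ xs} {ys} (x∉ ∷ xs!) inj into = begin
    suc (length xs)          ≤⟨ s≤s (length≤-injectiveOn f xs! (λ p q → inj (there p) (there q)) into′) ⟩
    suc (length (ys ─ fx∈))  ≡⟨ sym (length-removeAt′ ys _) ⟩
    length ys                ∎
    where
    open ≤-Reasoning
    fx∈ : f x ∈ ys
    fx∈ = into (here refl)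
    into′ : ∀ {y} → y ∈ xs → f y ∈ ys ─ fx∈
    into′ y∈ = ∈-─⁺ (into (there y∈)) fx∈
                    (λ fy≡fx → inj (here refl) (there y∈) (All.lookup x∉ y∈) (sym fy≡fx))

  Unique-⊆⇒length≤ : {xs ys : List A} → Unique xs → (∀ {x} → x ∈ xs → x ∈ ys) →
                     length xs ≤ length ys
  Unique-⊆⇒length≤ xs! = length≤-injectiveOn (λ x → x) xs! (λ _ _ x≢y → x≢y)

length-cartesianProduct : {A B : Set} (xs : List A) (ys : List B) →
                          length (cartesianProduct xs ys) ≡ length xs * length ys
length-cartesianProduct []       ys = refl
length-cartesianProduct (x ∷ xs) ys = begin
  length (map (x ,_) ys ++ cartesianProduct xs ys)        ≡⟨ length-++ (map (x ,_) ys) ⟩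
  length (map (x ,_) ys) + length (cartesianProduct xs ys) ≡⟨ cong₂ _+_ (length-map (x ,_) ys)
                                                                       (length-cartesianProduct xs ys) ⟩
  length ys + length xs * length ys                        ∎
  where open ≡-Reasoning

length-allFin : ∀ n → length (allFin n) ≡ n
length-allFin n = length-tabulate (λ i → i)

WithinDist : (G : Graph) → V G → V G → ℕ → Set
WithinDist G u v e = Σ ℕ λ m → m ≤ e × Walk G u v m

-- Stronger than the usual notion (every vertex, not only the neighbours of u and v, is
-- within distance d(u,v) of both), and all that is needed here.
record MutuallyMaximallyDistant (G : Graph) (u v : V G) : Set where
  field
    distance  : ℕ
    minimal   : ∀ m → Walk G u v m → distance ≤ m
    withinˡ   : ∀ w → WithinDist G w u distance
    withinʳ   : ∀ w → WithinDist G w v distance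

module _ {G : Graph} where

  walk-zero⇒≡ : ∀ {u v} → Walk G u v 0 → u ≡ v
  walk-zero⇒≡ here = refl

  walk-snoc : ∀ {u v w m} → Walk G u v m → Adj G v w → Walk G u w (suc m)
  walk-snoc here        a = step a here
  walk-snoc (step b ws) a = step b (walk-snoc ws a)

  ≢⇒1≤walk : ∀ {u v} → u ≢ v → ∀ m → Walk G u v m → 1 ≤ m
  ≢⇒1≤walk u≢v zero    ws = ⊥-elim (u≢v (walk-zero⇒≡ ws))
  ≢⇒1≤walk u≢v (suc m) ws = s≤s z≤n

  IsDist-refl : ∀ {u} → IsDist G u u 0
  IsDist-refl = here , λ _ _ → z≤n

  IsDist-adj : ∀ {u v} → u ≢ v → Adj G u v → IsDist G u v 1
  IsDist-adj u≢v a = step a here , ≢⇒1≤walk u≢v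

  IsDist-within : ∀ {u v d e} → IsDist G u v d → WithinDist G u v e → d ≤ e
  IsDist-within (_ , minimal) (m , m≤e , ws) = ≤-trans (minimal m ws) m≤e

  IsDist-zero⇒≡ : ∀ {u v} → IsDist G u v 0 → u ≡ v
  IsDist-zero⇒≡ (ws , _) = walk-zero⇒≡ ws

  stronglyResolves-self : ∀ {u v d} → IsDist G u v d → StronglyResolves G u u v
  stronglyResolves-self {d = d} duv = 0 , d , d , IsDist-refl , duv , duv , inj₂ refl

  stronglyResolves-other : ∀ {u v d} → IsDist G v u d → IsDist G u v d → StronglyResolves G v u v
  stronglyResolves-other {d = d} dvu duv = d , 0 , d , dvu , IsDist-refl , duv , inj₁ refl

  -- If d(w,u) = d(w,v) + d(v,u) while d(w,u) ≤ d(u,v), then d(w,v) = 0.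
  mutuallyMaximallyDistant-resolver : ∀ {u v w} → MutuallyMaximallyDistant G u v →
                                      StronglyResolves G w u v → w ≡ u ⊎ w ≡ v
  mutuallyMaximallyDistant-resolver {u} {v} {w} mmd (dwu , dwv , duv , wu , wv , uv , eq) = case eq
    where
    open MutuallyMaximallyDistant mmd
    vanishes : ∀ {x a b} → IsDist G w x a → WithinDist G w x distance → a ≡ b + duv → b ≡ 0
    vanishes {a = a} {b} dwx within a≡b+duv = n≤0⇒n≡0 (+-cancelʳ-≤ duv b 0 (begin
      b + duv  ≡⟨ sym a≡b+duv ⟩
      a        ≤⟨ IsDist-within dwx within ⟩
      distance ≤⟨ minimal duv (proj₁ uv) ⟩
      duv      ∎))
      where open ≤-Reasoning
    case : dwu ≡ dwv + duv ⊎ dwv ≡ dwu + duv → w ≡ u ⊎ w ≡ v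
    case (inj₁ e) = inj₂ (IsDist-zero⇒≡ (subst (IsDist G w v) (vanishes wu (withinˡ w) e) wv))
    case (inj₂ e) = inj₁ (IsDist-zero⇒≡ (subst (IsDist G w u) (vanishes wv (withinʳ w) e) wu))

  resolvingSet-meets : ∀ {S u v} → IsStrongResolvingSet G S → u ≢ v →
                       MutuallyMaximallyDistant G u v → u ∈ S ⊎ v ∈ S
  resolvingSet-meets resolving u≢v mmd
    with w , w∈S , resolves ← resolving _ _ u≢v
    with mutuallyMaximallyDistant-resolver mmd resolves
  ... | inj₁ refl = inj₁ w∈S
  ... | inj₂ refl = inj₂ w∈S

module StarSum (n n′ : ℕ) where

  G : Graph
  G = Star n ⊕ Complete n′

  Vertex : Set
  Vertex = Fin (suc n) × Fin n′

  Adj-irrefl : ∀ {u} → ¬ Adj G u u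
  Adj-irrefl (inj₁ ())
  Adj-irrefl (inj₂ b≢b) = b≢b refl

  IsDist-one : ∀ {u v} → Adj G u v → IsDist G u v 1
  IsDist-one a = IsDist-adj (λ { refl → Adj-irrefl a }) a

  leaf≢⇒2≤walk : ∀ {i j b} → i ≢ j → ∀ m → Walk G (fs i , b) (fs j , b) m → 2 ≤ m
  leaf≢⇒2≤walk i≢j zero ws = ⊥-elim (i≢j (Fin.suc-injective (cong proj₁ (walk-zero⇒≡ ws))))
  leaf≢⇒2≤walk i≢j (suc zero) (step (inj₁ ()) here)
  leaf≢⇒2≤walk i≢j (suc zero) (step (inj₂ b≢b) here) = ⊥-elim (b≢b refl)
  leaf≢⇒2≤walk i≢j (suc (suc m)) _ = s≤s (s≤s z≤n)

  IsDist-leaves : ∀ {i j b} → i ≢ j → IsDist G (fs i , b) (fs j , b) 2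
  IsDist-leaves {i} {j} {b} i≢j =
    step {v = fz , b} (inj₁ (leaf-center i)) (step (inj₁ (center-leaf j)) here) , leaf≢⇒2≤walk i≢j

  IsDist-exists : ∀ u v → u ≢ v → Σ ℕ λ d → IsDist G u v d × IsDist G v u d
  IsDist-exists (a , b) (c , d) u≢v with b Fin.≟ d
  ... | no b≢d = 1 , IsDist-one (inj₂ b≢d) , IsDist-one (inj₂ (λ d≡b → b≢d (sym d≡b)))
  IsDist-exists (fz   , b) (fz   , b) u≢v | yes refl = ⊥-elim (u≢v refl)
  IsDist-exists (fz   , b) (fs j , b) u≢v | yes refl =
    1 , IsDist-one (inj₁ (center-leaf j)) , IsDist-one (inj₁ (leaf-center j))
  IsDist-exists (fs i , b) (fz   , b) u≢v | yes refl =
    1 , IsDist-one (inj₁ (leaf-center i)) , IsDist-one (inj₁ (center-leaf i))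
  IsDist-exists (fs i , b) (fs j , b) u≢v | yes refl =
    2 , IsDist-leaves (λ { refl → u≢v refl }) , IsDist-leaves (λ { refl → u≢v refl })

  within-centre : ∀ w b → WithinDist G w (fz , b) 1
  within-centre (fz , b′) b with b′ Fin.≟ b
  ... | yes refl = 0 , z≤n , here
  ... | no b′≢b  = 1 , ≤-refl , step (inj₂ b′≢b) here
  within-centre (fs i , b′) b = 1 , ≤-refl , step (inj₁ (leaf-center i)) here

  within-leaf : ∀ w i b → WithinDist G w (fs i , b) 2
  within-leaf w i b with m , m≤1 , ws ← within-centre w b =
    suc m , s≤s m≤1 , walk-snoc ws (inj₁ (center-leaf i))

  centres-mmd : ∀ {b b′} → b ≢ b′ → MutuallyMaximallyDistant G (fz , b) (fz , b′)
  centres-mmd {b} {b′} b≢b′ = record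
    { distance = 1
    ; minimal  = ≢⇒1≤walk (λ e → b≢b′ (cong proj₂ e))
    ; withinˡ  = λ w → within-centre w b
    ; withinʳ  = λ w → within-centre w b′
    }

  leaves-mmd : ∀ {i j b} → i ≢ j → MutuallyMaximallyDistant G (fs i , b) (fs j , b)
  leaves-mmd {i} {j} {b} i≢j = record
    { distance = 2
    ; minimal  = leaf≢⇒2≤walk i≢j
    ; withinˡ  = λ w → within-leaf w i b
    ; withinʳ  = λ w → within-leaf w j b
    }

  -- The centre copies form one clique, the leaf copies of column b another.
  clique : Vertex → Fin (suc n′)
  clique (fz   , _) = fz
  clique (fs _ , b) = fs b

  sameClique⇒mmd : ∀ {u v} → u ≢ v → clique u ≡ clique v → MutuallyMaximallyDistant G u v
  sameClique⇒mmd {fz   , b} {fz   , b′} u≢v _    = centres-mmd (λ { refl → u≢v refl })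
  sameClique⇒mmd {fs i , b} {fs j , b}  u≢v refl = leaves-mmd (λ { refl → u≢v refl })
  sameClique⇒mmd {fz   , _} {fs _ , _}  _   ()
  sameClique⇒mmd {fs _ , _} {fz   , _}  _   ()

  vertices : List Vertex
  vertices = cartesianProduct (allFin (suc n)) (allFin n′)

  vertices-unique : Unique vertices
  vertices-unique = Unique.cartesianProduct⁺ (Unique.allFin⁺ (suc n)) (Unique.allFin⁺ n′)

  ∈-vertices : ∀ v → v ∈ vertices
  ∈-vertices (a , b) = ∈-cartesianProduct⁺ (∈-allFin a) (∈-allFin b)

  length-vertices : length vertices ≡ suc n * n′
  length-vertices = trans (length-cartesianProduct (allFin (suc n)) (allFin n′))
                          (cong₂ _*_ (length-allFin (suc n)) (length-allFin n′))

  open DecMembership {A = Vertex} (≡-dec Fin._≟_ Fin._≟_) using (_∈?_)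

  resolvingSet-length : ∀ S → Unique S → IsStrongResolvingSet G S → suc n * n′ ≤ suc n′ + length S
  resolvingSet-length S S! resolving = begin
    suc n * n′                               ≡⟨ sym length-vertices ⟩
    length vertices                          ≡⟨ sym (length-filter+filter-∁ (_∈? S) vertices) ⟩
    length inside + length outside           ≤⟨ +-mono-≤ inside≤S outside≤cliques ⟩
    length S + length (allFin (suc n′))      ≡⟨ cong₂ _+_ refl (length-allFin (suc n′)) ⟩
    length S + suc n′                        ≡⟨ +-comm (length S) (suc n′) ⟩
    suc n′ + length S                        ∎
    where
    open ≤-Reasoning
    inside outside : List Vertex
    inside  = filter (_∈? S) vertices
    outside = filter (∁? (_∈? S)) vertices
    inside≤S : length inside ≤ length S
    inside≤S = Unique-⊆⇒length≤ (Unique.filter⁺ (_∈? S) vertices-unique)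
                                (λ x∈ → proj₂ (∈-filter⁻ (_∈? S) {xs = vertices} x∈))
    -- Two distinct vertices outside S cannot share a clique, as one of them would lie in S.
    outside-cliques-distinct : ∀ {x y} → x ∈ outside → y ∈ outside → x ≢ y → clique x ≢ clique y
    outside-cliques-distinct x∈ y∈ x≢y same =
      [ proj₂ (∈-filter⁻ (∁? (_∈? S)) {xs = vertices} x∈)
      , proj₂ (∈-filter⁻ (∁? (_∈? S)) {xs = vertices} y∈) ]′
      (resolvingSet-meets resolving x≢y (sameClique⇒mmd x≢y same))
    outside≤cliques : length outside ≤ length (allFin (suc n′))
    outside≤cliques = length≤-injectiveOn clique (Unique.filter⁺ (∁? (_∈? S)) vertices-unique)
                        outside-cliques-distinct
                        (λ {x} _ → ∈-allFin (clique x))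

module Landmarks (m m′ : ℕ) where

  open StarSum (suc (suc m)) (suc m′) public

  Landmark : Vertex → Set
  Landmark (fz         , fz  ) = ⊥
  Landmark (fz         , fs _) = ⊤
  Landmark (fs fz      , _   ) = ⊥
  Landmark (fs (fs _)  , _   ) = ⊤

  landmark? : Decidable Landmark
  landmark? (fz        , fz  ) = no λ ()
  landmark? (fz        , fs _) = yes tt
  landmark? (fs fz     , _   ) = no λ ()
  landmark? (fs (fs _) , _   ) = yes tt

  landmarks : List Vertex
  landmarks = filter landmark? vertices

  landmarks-unique : Unique landmarks
  landmarks-unique = Unique.filter⁺ landmark? vertices-unique

  ∈-landmarks : ∀ v → Landmark v → v ∈ landmarks
  ∈-landmarks v = ∈-filter⁺ landmark? (∈-vertices v)

  -- The second leaf copy in the column of b separates the omitted vertices.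
  nonLandmarks-resolved : ∀ u v → ¬ Landmark u → ¬ Landmark v → u ≢ v →
                          Σ Vertex λ w → w ∈ landmarks × StronglyResolves G w u v
  nonLandmarks-resolved (fz , fs _) _ ¬u _ _ = ⊥-elim (¬u tt)
  nonLandmarks-resolved (fs (fs _) , _) _ ¬u _ _ = ⊥-elim (¬u tt)
  nonLandmarks-resolved _ (fz , fs _) _ ¬v _ = ⊥-elim (¬v tt)
  nonLandmarks-resolved _ (fs (fs _) , _) _ ¬v _ = ⊥-elim (¬v tt)
  nonLandmarks-resolved (fz , fz) (fz , fz) _ _ u≢v = ⊥-elim (u≢v refl)
  nonLandmarks-resolved (fz , fz) (fs fz , b) _ _ _ =
    (fs (fs fz) , b) , ∈-landmarks _ tt ,
    1 , 2 , 1 , IsDist-one (inj₁ (leaf-center (fs fz))) , IsDist-leaves (λ ()) ,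
    IsDist-one (inj₁ (center-leaf fz)) , inj₂ refl
  nonLandmarks-resolved (fs fz , b) (fz , fz) _ _ _ =
    (fs (fs fz) , b) , ∈-landmarks _ tt ,
    2 , 1 , 1 , IsDist-leaves (λ ()) , IsDist-one (inj₁ (leaf-center (fs fz))) ,
    IsDist-one (inj₁ (leaf-center fz)) , inj₁ refl
  nonLandmarks-resolved (fs fz , b) (fs fz , b′) _ _ u≢v =
    (fs (fs fz) , b) , ∈-landmarks _ tt ,
    2 , 1 , 1 , IsDist-leaves (λ ()) , IsDist-one (inj₂ b≢b′) , IsDist-one (inj₂ b≢b′) , inj₁ refl
    where
    b≢b′ : b ≢ b′
    b≢b′ refl = u≢v refl

  landmarks-resolving : IsStrongResolvingSet G landmarks
  landmarks-resolving u v u≢v with d , duv , dvu ← IsDist-exists u v u≢v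
                              with landmark? u | landmark? v
  ... | yes ℓu | _      = u , ∈-landmarks u ℓu , stronglyResolves-self duv
  ... | no _   | yes ℓv = v , ∈-landmarks v ℓv , stronglyResolves-other dvu duv
  ... | no ¬ℓu | no ¬ℓv = nonLandmarks-resolved u v ¬ℓu ¬ℓv u≢v

  firstLeaf : Fin (suc m′) → Vertex
  firstLeaf b = fs fz , b

  omitted : List Vertex
  omitted = (fz , fz) ∷ map firstLeaf (allFin (suc m′))

  omitted-unique : Unique omitted
  omitted-unique = All.tabulate first-fresh ∷ Unique.map⁺ (cong proj₂) (Unique.allFin⁺ (suc m′))
    where
    first-fresh : ∀ {v} → v ∈ map firstLeaf (allFin (suc m′)) → (fz , fz) ≢ v
    first-fresh v∈ with ∈-map⁻ firstLeaf v∈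
    ... | _ , _ , refl = λ ()

  omitted-nonLandmarks : ∀ {v} → v ∈ omitted → ¬ Landmark v
  omitted-nonLandmarks (here refl) = λ ()
  omitted-nonLandmarks (there v∈) with ∈-map⁻ firstLeaf v∈
  ... | _ , _ , refl = λ ()

  length-firstLeaves : length (map firstLeaf (allFin (suc m′))) ≡ suc m′
  length-firstLeaves = trans (length-map firstLeaf (allFin (suc m′))) (length-allFin (suc m′))

  landmarks-length : length landmarks + suc (suc m′) ≤ suc (suc (suc m)) * suc m′
  landmarks-length = begin
    length landmarks + suc (suc m′)        ≡⟨ cong (λ k → length landmarks + suc k) (sym length-firstLeaves) ⟩
    length landmarks + length omitted      ≤⟨ +-monoʳ-≤ (length landmarks) omitted≤nonLandmarks ⟩
    length landmarks + length nonLandmarks ≡⟨ length-filter+filter-∁ landmark? vertices ⟩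
    length vertices                        ≡⟨ length-vertices ⟩
    suc (suc (suc m)) * suc m′             ∎
    where
    open ≤-Reasoning
    nonLandmarks : List Vertex
    nonLandmarks = filter (∁? landmark?) vertices
    omitted≤nonLandmarks : length omitted ≤ length nonLandmarks
    omitted≤nonLandmarks = Unique-⊆⇒length≤ omitted-unique
      (λ {v} v∈ → ∈-filter⁺ (∁? landmark?) (∈-vertices v) (omitted-nonLandmarks v∈))

  landmarks-minimum : ∀ S → Unique S → IsStrongResolvingSet G S → length landmarks ≤ length S
  landmarks-minimum S S! resolving = +-cancelʳ-≤ (suc (suc m′)) (length landmarks) (length S) (begin
    length landmarks + suc (suc m′) ≤⟨ landmarks-length ⟩
    suc (suc (suc m)) * suc m′      ≤⟨ resolvingSet-length S S! resolving ⟩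
    suc (suc m′) + length S         ≡⟨ +-comm (suc (suc m′)) (length S) ⟩
    length S + suc (suc m′)         ∎)
    where open ≤-Reasoning

exact⇒bounds : ∀ {x k n′} → 1 ≤ n′ → x ≤ suc n′ + k → k + suc n′ ≤ x →
               (x ∸ 2 * n′ ≤ k) × (k ≤ x ∸ n′ ∸ 1)
exact⇒bounds {x} {k} {n′} 1≤n′ x≤ ≤x = lower , upper
  where
  suc-n′≤2*n′ : suc n′ ≤ 2 * n′
  suc-n′≤2*n′ = ≤-trans (+-monoˡ-≤ n′ 1≤n′) (≤-reflexive (cong (n′ +_) (sym (+-identityʳ n′))))
  lower : x ∸ 2 * n′ ≤ k
  lower = m≤n+o⇒m∸n≤o x (2 * n′) (≤-trans x≤ (+-monoˡ-≤ k suc-n′≤2*n′))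
  upper : k ≤ x ∸ n′ ∸ 1
  upper = subst (k ≤_) (sym (trans (∸-+-assoc x n′ 1) (cong (x ∸_) (+-comm n′ 1))))
                (m+n≤o⇒m≤o∸n k ≤x)

corollary5 : (n n′ : ℕ) → 2 ≤ n → 2 ≤ n′ →
    Σ ℕ λ k → IsStrongMetricDim (Star n ⊕ Complete n′) k ×
      ((suc n * n′ ∸ 2 * n′ ≤ k) × (k ≤ suc n * n′ ∸ n′ ∸ 1))
corollary5 (suc (suc m)) (suc (suc m′)) (s≤s (s≤s z≤n)) (s≤s (s≤s z≤n)) =
  length landmarks ,
  ((landmarks , landmarks-unique , landmarks-resolving , refl) , landmarks-minimum) ,
  exact⇒bounds (s≤s z≤n) (resolvingSet-length landmarks landmarks-unique landmarks-resolving)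
               landmarks-length
  where
  open Landmarks m (suc m′)
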